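{- Let $k$ be a positive integer, let $G$ be a graph with $n$ vertices and let $G'$ be its complement. Let $H$ be the graph obtained from $G'$ by adding a set $X$ of $n+1$ new pairwise non-adjacent vertices and making each vertex of $X$ adjacent to every vertex of $G'$. Then $G$ is $k$-colourable if and only if $\mathrm{tcl}(H)\le k$.
   Context: All graphs are finite, simple and undirected. For a graph $G$ and $X\subseteq V(G)$, let $\mathrm{vcc}(X)$ be the minimum number of cliques of $G$ whose union is $X$. A tree decomposition of $G$ is a pair $(T,\{X_t\}_{t\in V(T)})$ with $T$ a tree and bags $X_t\subseteq V(G)$ such that every vertex lies in some bag, both endpoints of every edge lie in a common bag, and for every vertex $v$ the nodes $t$ with $v\in X_t$ induce a connected subtree of $T$. An augmented tree decomposition is a tree decomposition together with, for each node $t$, a collection $C_t$ of cliques of $G$ whose union is $X_t$; its width is $\max_t |C_t|$. The tree-clique width $\mathrm{tcl}(G)$ is the minimum width of an augmented tree decomposition of $G$, i.e. the minimum over tree decompositions of $\max_t \mathrm{vcc}(X_t)$. -}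

module Defs where

open import Data.Nat using (ℕ; zero; suc; _+_; _≤_)
open import Data.Fin using (Fin; zero; suc; inject₁; fromℕ; splitAt)
open import Data.Fin.Subset using (Subset; _∈_; ⋃)
open import Data.List using (List; length)
open import Data.List.Relation.Unary.All using (All)
open import Data.Sum using (_⊎_; inj₁; inj₂)
open import Data.Product using (Σ; ∃; ∃-syntax; _×_; _,_)
open import Data.Unit using (⊤; tt)
open import Data.Empty using (⊥)
open import Relation.Nullary using (¬_)
open import Relation.Binary.PropositionalEquality using (_≡_; _≢_; refl; sym)
open import Function.Definitions using (Injective)

record Graph (n : ℕ) : Set₁ where
  field
    Adj    : Fin n → Fin n → Set
    adj-sym    : ∀ {u v} → Adj u v → Adj v u
    adj-irrefl : ∀ {u} → ¬ Adj u u
open Graph public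

complement : ∀ {n} → Graph n → Graph n
complement G = record
  { Adj        = λ u v → (u ≢ v) × ¬ Adj G u v
  ; adj-sym    = λ { (u≢v , ¬a) → (λ e → u≢v (sym e)) , (λ a → ¬a (Graph.adj-sym G a)) }
  ; adj-irrefl = λ { (u≢u , _) → u≢u refl }
  }

ConeAdj : ∀ {n m} → (Fin n → Fin n → Set) → Fin n ⊎ Fin m → Fin n ⊎ Fin m → Set
ConeAdj A (inj₁ a) (inj₁ b) = A a b
ConeAdj A (inj₁ _) (inj₂ _) = ⊤
ConeAdj A (inj₂ _) (inj₁ _) = ⊤
ConeAdj A (inj₂ _) (inj₂ _) = ⊥

ConeAdj-sym : ∀ {n m} (G : Graph n) (x y : Fin n ⊎ Fin m) →
              ConeAdj (Adj G) x y → ConeAdj (Adj G) y x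
ConeAdj-sym G (inj₁ a) (inj₁ b) p = Graph.adj-sym G p
ConeAdj-sym G (inj₁ _) (inj₂ _) p = tt
ConeAdj-sym G (inj₂ _) (inj₁ _) p = tt

ConeAdj-irrefl : ∀ {n m} (G : Graph n) (x : Fin n ⊎ Fin m) → ¬ ConeAdj (Adj G) x x
ConeAdj-irrefl G (inj₁ a) p = Graph.adj-irrefl G p
ConeAdj-irrefl G (inj₂ _) ()

-- Vertex set: Fin (n + m); the first n
-- vertices are those of G, the last m are the new ones.
cone : ∀ {n} → Graph n → (m : ℕ) → Graph (n + m)
cone {n} G m = record
  { Adj        = λ u v → ConeAdj (Adj G) (splitAt n u) (splitAt n v)
  ; adj-sym    = λ {u} {v} p → ConeAdj-sym G (splitAt n u) (splitAt n v) p
  ; adj-irrefl = λ {u} p → ConeAdj-irrefl G (splitAt n u) p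
  }

H : ∀ {n} → Graph n → Graph (n + suc n)
H {n} G = cone (complement G) (suc n)

Colourable : ∀ {n} → Graph n → ℕ → Set
Colourable {n} G k = Σ (Fin n → Fin k) λ c → ∀ u v → Adj G u v → c u ≢ c v

IsClique : ∀ {n} → Graph n → Subset n → Set
IsClique G S = ∀ u v → u ∈ S → v ∈ S → u ≢ v → Adj G u v

data Walk {m : ℕ} (A : Fin m → Fin m → Set) (P : Fin m → Set) : Fin m → Fin m → Set where
  here : ∀ {u} → P u → Walk A P u u
  step : ∀ {u w v} → P u → A u w → Walk A P w v → Walk A P u v

InducesConnected : ∀ {m} → Graph m → (Fin m → Set) → Set
InducesConnected T P = ∀ u v → P u → P v → Walk (Adj T) P u v

HasCycle : ∀ {m} → Graph m → Set
HasCycle {m} T = Σ ℕ λ r → Σ (Fin (3 + r) → Fin m) λ c →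
  Injective _≡_ _≡_ c
  × (∀ (i : Fin (2 + r)) → Adj T (c (inject₁ i)) (c (suc i)))
  × Adj T (c (fromℕ (2 + r))) (c zero)

record Tree (m : ℕ) : Set₁ where
  field
    graph     : Graph m
    connected : InducesConnected graph (λ _ → ⊤)
    acyclic   : ¬ HasCycle graph

record TreeDecomposition {N : ℕ} (G : Graph N) : Set₁ where
  field
    nodes    : ℕ
    tree     : Tree nodes
    bag      : Fin nodes → Subset N
    covers   : ∀ v → ∃[ t ] (v ∈ bag t)
    edges    : ∀ u v → Adj G u v → ∃[ t ] (u ∈ bag t × v ∈ bag t)
    coherent : ∀ v → InducesConnected (Tree.graph tree) (λ t → v ∈ bag t)
open TreeDecomposition public

VccAtMost : ∀ {N} → Graph N → Subset N → ℕ → Set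
VccAtMost {N} G X k = Σ (List (Subset N)) λ Cs →
  All (IsClique G) Cs × ⋃ Cs ≡ X × length Cs ≤ k

TclAtMost : ∀ {N} → Graph N → ℕ → Set₁
TclAtMost G k = Σ (TreeDecomposition G) λ D → ∀ t → VccAtMost G (bag D t) k

module Submission where

-- A proper k-colouring of G splits the vertices of the complement G′ into k cliques, so the star
-- with centre bag V(G′) and one leaf bag V(G′) ∪ {x} per new vertex x is a tree decomposition of H
-- whose bags are unions of k cliques (x joins any one of them).  Conversely, the subtrees of a tree
-- decomposition have the Helly property, and as V(G′) and X are completely joined this puts all
-- of X or all of V(G′) into one bag.  The n + 1 vertices of X are pairwise non-adjacent, so when
-- k ≤ n that bag contains V(G′), and its at most k cliques of G′ are the colour classes of a
-- k-colouring of G; when k ≥ n, G is k-colourable anyway.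

open import Defs
open import Data.Nat as ℕ using (ℕ; zero; suc; _+_; _≤_; _<_; z≤n; s≤s)
import Data.Nat.Properties as ℕ
open import Data.Fin as Fin using (Fin; #_; toℕ; fromℕ; inject₁; inject≤; splitAt; _↑ˡ_; _↑ʳ_)
import Data.Fin.Properties as Fin
open import Data.Fin.Subset using (Subset; ⋃; _⊆_) renaming (_∈_ to _∈ₛ_)
open import Data.Fin.Subset.Properties using (_∈?_; ∉⊥; x∈p∪q⁻; p⊆p∪q; q⊆p∪q; ⊆-antisym)
open import Data.List as List using (List; []; _∷_; length; filter; allFin)
open import Data.List.Membership.Propositional using (_∈_)
open import Data.List.Membership.Propositional.Properties using (∈-filter⁺; ∈-allFin)
import Data.List.Properties as List
import Data.List.Relation.Unary.All as All
import Data.List.Relation.Unary.All.Properties as All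
open import Data.List.Relation.Unary.Any as Any using (Any; here; there)
import Data.List.Relation.Unary.Any.Properties as Any
import Data.Vec as Vec
import Data.Vec.Properties as Vec
open import Data.Bool using (true)
open import Data.Sum using (_⊎_; inj₁; inj₂; [_,_]′)
open import Data.Product using (Σ; ∃; ∃-syntax; _×_; _,_; proj₁; proj₂)
open import Data.Unit using (⊤; tt)
open import Data.Empty using (⊥; ⊥-elim)
open import Function using (_∘_; const)
open import Function.Bundles using (_⇔_; mk⇔)
open import Relation.Nullary using (¬_; contradiction; Dec; yes; no; does)
open import Relation.Nullary.Decidable using (decidable-stable; dec-true; ¬?; _×-dec_; _⊎-dec_; ¬¬-excluded-middle)
open import Relation.Unary using (Decidable)
open import Relation.Binary.PropositionalEquality using (_≡_; _≢_; refl; sym; trans; cong; subst; module ≡-Reasoning)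

module _ {m : ℕ} {A : Fin m → Fin m → Set} where

  walk-source : ∀ {P u v} → Walk A P u v → P u
  walk-source (here p)     = p
  walk-source (step p _ _) = p

  walk-map : ∀ {P Q : Fin m → Set} → (∀ x → P x → Q x) → ∀ {u v} → Walk A P u v → Walk A Q u v
  walk-map f (here p)       = here (f _ p)
  walk-map f (step p a w)   = step (f _ p) a (walk-map f w)

  walk-++ : ∀ {P u w v} → Walk A P u w → Walk A P w v → Walk A P u v
  walk-++ (here _)       w′ = w′
  walk-++ (step p a w)   w′ = step p a (walk-++ w w′)

  walk-from-isolated : ∀ {P u v} → (∀ w → P w → ¬ A u w) → Walk A P u v → u ≡ v
  walk-from-isolated iso (here _)       = refl
  walk-from-isolated iso (step _ a w)   = ⊥-elim (iso _ (walk-source w) a)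

  -- A walk through a vertex ℓ whose neighbours in P all equal p enters and leaves ℓ through p,
  -- so the detour p → ℓ → p can be cut out.
  walk-avoiding : ∀ {P ℓ p} → (∀ w → P w → A ℓ w → w ≡ p) → (∀ {u w} → A u w → A w u) →
                  ∀ {u v} → Walk A P u v → u ≢ ℓ → v ≢ ℓ → Walk A (λ t → P t × t ≢ ℓ) u v
  walk-avoiding nbr sym-A (here pu) u≢ℓ v≢ℓ = here (pu , u≢ℓ)
  walk-avoiding {ℓ = ℓ} nbr sym-A (step {u} {w} pu a rest) u≢ℓ v≢ℓ with w Fin.≟ ℓ
  ... | no w≢ℓ = step (pu , u≢ℓ) a (walk-avoiding nbr sym-A rest w≢ℓ v≢ℓ)
  ... | yes refl with rest
  ...   | here _ = ⊥-elim (v≢ℓ refl)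
  ...   | step {w = w′} _ a′ rest′ =
    subst (λ z → Walk A _ z _) w′≡u (walk-avoiding nbr sym-A rest′ (λ e → u≢ℓ (trans (sym w′≡u) e)) v≢ℓ)
    where
      w′≡u : w′ ≡ u
      w′≡u = trans (nbr w′ (walk-source rest′) a′) (sym (nbr u pu (sym-A a)))

module _ {m : ℕ} (Γ : Graph m) where

  singleton-connected : ∀ {P : Fin m → Set} s → (∀ t → P t → t ≡ s) → InducesConnected Γ P
  singleton-connected s only u v pu pv =
    subst (Walk (Adj Γ) _ u) (trans (only u pu) (sym (only v pv))) (here pu)

  ∪-connected : ∀ {P Q : Fin m → Set} → InducesConnected Γ P → InducesConnected Γ Q →
                ∀ {s} → P s → Q s → InducesConnected Γ (λ t → P t ⊎ Q t)
  ∪-connected {P} {Q} P-conn Q-conn {s} Ps Qs u v pu pv = walk-++ (to-s pu) (from-s pv)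
    where
      to-s : ∀ {u} → P u ⊎ Q u → Walk (Adj Γ) (λ t → P t ⊎ Q t) u s
      to-s (inj₁ pu) = walk-map (λ _ → inj₁) (P-conn _ s pu Ps)
      to-s (inj₂ qu) = walk-map (λ _ → inj₂) (Q-conn _ s qu Qs)
      from-s : ∀ {v} → P v ⊎ Q v → Walk (Adj Γ) (λ t → P t ⊎ Q t) s v
      from-s (inj₁ pv) = walk-map (λ _ → inj₁) (P-conn s _ Ps pv)
      from-s (inj₂ qv) = walk-map (λ _ → inj₂) (Q-conn s _ Qs qv)

module _ {n : ℕ} where

  ⟦_⟧ : {P : Fin n → Set} → Decidable P → Subset n
  ⟦ P? ⟧ = Vec.tabulate (does ∘ P?)

  ∈⟦⟧⁺ : ∀ {P : Fin n → Set} (P? : Decidable P) {x} → P x → x ∈ₛ ⟦ P? ⟧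
  ∈⟦⟧⁺ P? {x} px = Vec.lookup⇒[]= x _ (trans (Vec.lookup∘tabulate _ x) (dec-true (P? x) px))

  ∈⟦⟧⁻ : ∀ {P : Fin n → Set} (P? : Decidable P) {x} → x ∈ₛ ⟦ P? ⟧ → P x
  ∈⟦⟧⁻ P? {x} x∈ = witness (P? x) (trans (sym (Vec.lookup∘tabulate _ x)) (Vec.[]=⇒lookup x∈))
    where
      witness : ∀ {A : Set} (a? : Dec A) → does a? ≡ true → A
      witness (yes a) _ = a

  ∈⋃⁺ : ∀ (Cs : List (Subset n)) {x} → Any (x ∈ₛ_) Cs → x ∈ₛ ⋃ Cs
  ∈⋃⁺ (C ∷ Cs) (here x∈C)    = p⊆p∪q (⋃ Cs) x∈C
  ∈⋃⁺ (C ∷ Cs) (there x∈Cs)  = q⊆p∪q C (⋃ Cs) (∈⋃⁺ Cs x∈Cs)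

  ∈⋃⁻ : ∀ (Cs : List (Subset n)) {x} → x ∈ₛ ⋃ Cs → Any (x ∈ₛ_) Cs
  ∈⋃⁻ []       x∈ = ⊥-elim (∉⊥ x∈)
  ∈⋃⁻ (C ∷ Cs) x∈ with x∈p∪q⁻ C (⋃ Cs) x∈
  ... | inj₁ x∈C  = here x∈C
  ... | inj₂ x∈Cs = there (∈⋃⁻ Cs x∈Cs)

module Subtrees {m : ℕ} (T : Tree m) where

  open Tree T using (graph; acyclic)

  E : Fin m → Fin m → Set
  E = Adj graph

  record Path (S : Fin m → Set) : Set where
    field
      len       : ℕ
      vertex    : ℕ → Fin m
      injective : ∀ a b → a ≤ len → b ≤ len → vertex a ≡ vertex b → a ≡ b
      adjacent  : ∀ a → a < len → E (vertex a) (vertex (suc a))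
      inside    : ∀ a → a ≤ len → S (vertex a)

    len≱m : ¬ m ≤ len
    len≱m m≤len with Fin.pigeonhole (s≤s m≤len) (vertex ∘ toℕ)
    ... | i , j , i<j , eq = ℕ.<-irrefl (injective _ _ (bound i) (bound j) eq) i<j
      where
        bound : (i : Fin (suc len)) → toℕ i ≤ len
        bound i = ℕ.≤-pred (Fin.toℕ<n i)

    no-chord : ∀ r → 2 + r ≤ len → ¬ E (vertex 0) (vertex (2 + r))
    no-chord r r+2≤len chord = acyclic (r , cycle , cycle-injective , cycle-adjacent , cycle-closed)
      where
        bound : (i : Fin (3 + r)) → toℕ i ≤ len
        bound i = ℕ.≤-trans (ℕ.≤-pred (Fin.toℕ<n i)) r+2≤len
        cycle : Fin (3 + r) → Fin m
        cycle i = vertex (toℕ i)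
        cycle-injective : ∀ {i j} → cycle i ≡ cycle j → i ≡ j
        cycle-injective {i} {j} eq = Fin.toℕ-injective (injective _ _ (bound i) (bound j) eq)
        cycle-adjacent : (i : Fin (2 + r)) → E (cycle (inject₁ i)) (cycle (Fin.suc i))
        cycle-adjacent i rewrite Fin.toℕ-inject₁ i = adjacent (toℕ i) (ℕ.<-≤-trans (Fin.toℕ<n i) r+2≤len)
        cycle-closed : E (cycle (fromℕ (2 + r))) (cycle Fin.zero)
        cycle-closed rewrite Fin.toℕ-fromℕ (2 + r) = Graph.adj-sym graph chord

    OffPath : Fin m → Set
    OffPath w = ∀ a → a ≤ len → vertex a ≢ w

    Extendable : Set
    Extendable = ∃[ w ] (S w × E (vertex 0) w × OffPath w)

    prepend : ∀ w → S w → E w (vertex 0) → OffPath w → Path S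
    prepend w Sw w~v₀ off = record
      { len = suc len ; vertex = vertex′ ; injective = injective′ ; adjacent = adjacent′ ; inside = inside′ }
      where
        vertex′ : ℕ → Fin m
        vertex′ zero    = w
        vertex′ (suc a) = vertex a
        injective′ : ∀ a b → a ≤ suc len → b ≤ suc len → vertex′ a ≡ vertex′ b → a ≡ b
        injective′ zero    zero    _         _         _  = refl
        injective′ zero    (suc b) _         (s≤s b≤)  eq = ⊥-elim (off b b≤ (sym eq))
        injective′ (suc a) zero    (s≤s a≤)  _         eq = ⊥-elim (off a a≤ eq)
        injective′ (suc a) (suc b) (s≤s a≤)  (s≤s b≤)  eq = cong suc (injective a b a≤ b≤ eq)
        adjacent′ : ∀ a → a < suc len → E (vertex′ a) (vertex′ (suc a))
        adjacent′ zero    _        = w~v₀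
        adjacent′ (suc a) (s≤s a<) = adjacent a a<
        inside′ : ∀ a → a ≤ suc len → S (vertex′ a)
        inside′ zero    _        = Sw
        inside′ (suc a) (s≤s a≤) = inside a a≤

    -- If the path cannot be extended at its start, every neighbour of the start is on the path,
    -- and by acyclicity it can only be the second vertex.
    unextendable-start : ¬ Extendable →
                         ∀ w → S w → E (vertex 0) w → w ≡ vertex 1
    unextendable-start maximal w Sw v₀~w = decidable-stable (w Fin.≟ vertex 1) λ w≢v₁ →
      maximal (w , Sw , v₀~w , λ
        { zero          _      v₀≡w → Graph.adj-irrefl graph (subst (E (vertex 0)) (sym v₀≡w) v₀~w)
        ; (suc zero)    _      v₁≡w → w≢v₁ (sym v₁≡w)
        ; (suc (suc r)) r+2≤len vᵣ≡w → no-chord r r+2≤len (subst (E (vertex 0)) (sym vᵣ≡w) v₀~w) })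

  open Path

  data LeafOf (S : Fin m → Set) (ℓ : Fin m) : Set where
    isolated : (∀ w → S w → ¬ E ℓ w) → LeafOf S ℓ
    pendant  : ∀ {p} → S p → E ℓ p → (∀ w → S w → E ℓ w → w ≡ p) → LeafOf S ℓ

  module _ {S : Fin m → Set} where

    -- Adjacency in T is not decidable, so a leaf is only found under double negation;
    -- the conclusion of helly is decidable, which removes it again.
    ¬¬leaf-from-path : ∀ g (π : Path S) → m ≤ len π + g → ¬ ¬ (∃[ ℓ ] (S ℓ × LeafOf S ℓ))
    ¬¬leaf-from-path zero    π m≤len _ = len≱m π (subst (m ≤_) (ℕ.+-identityʳ _) m≤len)
    ¬¬leaf-from-path (suc g) π m≤len+g no-leaf = ¬¬-excluded-middle {A = Extendable π} λ
      { (yes (w , Sw , v₀~w , off)) →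
          ¬¬leaf-from-path g (prepend π w Sw (Graph.adj-sym graph v₀~w) off)
                           (subst (m ≤_) (ℕ.+-suc (len π) g) m≤len+g) no-leaf
      ; (no maximal) → ¬¬-excluded-middle {A = ∃[ p ] (S p × E (vertex π 0) p)} λ
          { (yes (p , Sp , v₀~p)) → no-leaf (vertex π 0 , inside π 0 z≤n , pendant Sp v₀~p
              (λ w Sw v₀~w → trans (unextendable-start π maximal w Sw v₀~w)
                                   (sym (unextendable-start π maximal p Sp v₀~p))))
          ; (no no-neighbour) → no-leaf (vertex π 0 , inside π 0 z≤n ,
              isolated (λ w Sw v₀~w → no-neighbour (w , Sw , v₀~w))) } }

    ¬¬leaf : ∀ {s} → S s → ¬ ¬ (∃[ ℓ ] (S ℓ × LeafOf S ℓ))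
    ¬¬leaf {s} Ss = ¬¬leaf-from-path m trivial ℕ.≤-refl
      where
        trivial : Path S
        trivial = record
          { len = 0 ; vertex = const s ; injective = λ { _ _ z≤n z≤n _ → refl }
          ; adjacent = λ _ () ; inside = λ _ _ → Ss }

  record SubtreeFamily (q : ℕ) : Set₁ where
    field
      member       : Fin (suc q) → Fin m → Set
      member?      : ∀ i → Decidable (member i)
      connected    : ∀ i → InducesConnected graph (member i)
      intersecting : ∀ i j → ∃[ t ] (member i t × member j t)

    Common : Fin m → Set
    Common t = ∀ i → member i t

    singleton⇒common : ∀ i {ℓ} → (∀ t → member i t → t ≡ ℓ) → Common ℓ
    singleton⇒common i only j with intersecting i j
    ... | t , it , jt = subst (member j) (only t it) jt

    confined : ∀ i {ℓ} → member i ℓ → (∀ w → member i w → ¬ E ℓ w) → ∀ t → member i t → t ≡ ℓ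
    confined i iℓ iso t it = sym (walk-from-isolated iso (connected i _ t iℓ it))

  open SubtreeFamily

  module Contract {q} (F : SubtreeFamily q) {ℓ p} (ℓ~p : E ℓ p)
                  (neighbour : ∀ i w → member F i w → E ℓ w → w ≡ p) where

    contracted : Fin (suc q) → Fin m → Set
    contracted i t = (member F i t × t ≢ ℓ) ⊎ (t ≡ p × member F i ℓ)

    p≢ℓ : p ≢ ℓ
    p≢ℓ refl = Graph.adj-irrefl graph ℓ~p

    confined-without-p : ∀ i → ¬ member F i p → member F i ℓ → ∀ t → member F i t → t ≡ ℓ
    confined-without-p i i∌p iℓ = confined F i iℓ λ w iw ℓ~w →
      i∌p (subst (member F i) (neighbour i w iw ℓ~w) iw)

    contracted-shape : ∀ i → (∀ t → contracted i t → member F i t × t ≢ ℓ)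
                           ⊎ (∀ t → contracted i t → t ≡ p)
    contracted-shape i with member? F i ℓ | member? F i p
    ... | no i∌ℓ | _     = inj₁ λ { t (inj₁ it) → it ; t (inj₂ (_ , iℓ)) → ⊥-elim (i∌ℓ iℓ) }
    ... | yes _  | yes ip = inj₁ λ { t (inj₁ it) → it ; t (inj₂ (refl , _)) → ip , p≢ℓ }
    ... | yes iℓ | no i∌p = inj₂ λ
      { t (inj₁ (it , t≢ℓ)) → ⊥-elim (t≢ℓ (confined-without-p i i∌p iℓ t it))
      ; t (inj₂ (t≡p , _))  → t≡p }

    family : SubtreeFamily q
    family = record
      { member       = contracted
      ; member?      = λ i t → (member? F i t ×-dec ¬? (t Fin.≟ ℓ)) ⊎-dec ((t Fin.≟ p) ×-dec member? F i ℓ)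
      ; connected    = connected′
      ; intersecting = intersecting′ }
      where
        connected′ : ∀ i → InducesConnected graph (contracted i)
        connected′ i u v cu cv with contracted-shape i
        ... | inj₁ keep with keep u cu | keep v cv
        ...   | iu , u≢ℓ | iv , v≢ℓ = walk-map (λ _ → inj₁)
          (walk-avoiding (neighbour i) (Graph.adj-sym graph) (connected F i u v iu iv) u≢ℓ v≢ℓ)
        connected′ i u v cu cv | inj₂ only-p = singleton-connected graph p only-p u v cu cv
        intersecting′ : ∀ i j → ∃[ t ] (contracted i t × contracted j t)
        intersecting′ i j with intersecting F i j
        ... | t , it , jt with t Fin.≟ ℓ
        ...   | yes refl = p , inj₂ (refl , it) , inj₂ (refl , jt)
        ...   | no t≢ℓ   = t , inj₁ (it , t≢ℓ) , inj₁ (jt , t≢ℓ)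

    common⇒common : ∀ {t} → Common family t → ∃ (Common F)
    common⇒common {t} common with t Fin.≟ p
    ... | no t≢p = t , λ i → uncontract i (common i)
      where
        uncontract : ∀ i → contracted i t → member F i t
        uncontract i (inj₁ (it , _))  = it
        uncontract i (inj₂ (t≡p , _)) = ⊥-elim (t≢p t≡p)
    ... | yes refl with Fin.all? (λ i → member? F i p)
    ...   | yes all-p = p , all-p
    ...   | no ¬all-p with Fin.¬∀⟶∃¬ _ (λ i → member F i p) (λ i → member? F i p) ¬all-p
    ...     | i , i∌p with common i
    ...       | inj₁ (ip , _)  = ⊥-elim (i∌p ip)
    ...       | inj₂ (_ , iℓ)  = ℓ , singleton⇒common F i (confined-without-p i i∌p iℓ)

  -- Induction on a list S containing all members: remove a leaf ℓ of S, after contracting ℓ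
  -- into its neighbour if it has one.
  ¬¬helly-within : ∀ {q} g (S : List (Fin m)) → length S ≤ g → (F : SubtreeFamily q) →
                   (∀ i t → member F i t → t ∈ S) → ¬ ¬ (∃ (Common F))
  ¬¬helly-within zero S |S|≤0 F inside no-common with intersecting F Fin.zero Fin.zero
  ... | t , t∈F₀ , _ with S | inside Fin.zero t t∈F₀
  ...   | _ ∷ _ | _ with () ← |S|≤0
  ¬¬helly-within (suc g) S |S|≤1+g F inside no-common with intersecting F Fin.zero Fin.zero
  ... | s , s∈F₀ , _ = ¬¬leaf (inside Fin.zero s s∈F₀) λ (ℓ , ℓ∈S , leaf) → remove ℓ ℓ∈S leaf
    where
      S-ℓ : Fin m → List (Fin m)
      S-ℓ ℓ = filter (λ t → ¬? (t Fin.≟ ℓ)) S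

      shorter : ∀ {ℓ} → ℓ ∈ S → length (S-ℓ ℓ) ≤ g
      shorter {ℓ} ℓ∈S = ℕ.≤-pred (ℕ.<-≤-trans
        (List.filter-notAll (λ t → ¬? (t Fin.≟ ℓ)) S (Any.map (λ ℓ≡t t≢ℓ → t≢ℓ (sym ℓ≡t)) ℓ∈S)) |S|≤1+g)

      keep : ∀ {ℓ t} → t ∈ S → t ≢ ℓ → t ∈ S-ℓ ℓ
      keep = ∈-filter⁺ (λ t → ¬? (t Fin.≟ _))

      remove : ∀ ℓ → ℓ ∈ S → LeafOf (_∈ S) ℓ → ⊥
      remove ℓ ℓ∈S (isolated no-nbr) with Fin.any? (λ i → member? F i ℓ)
      ... | yes (i , iℓ) = no-common
        (ℓ , singleton⇒common F i (confined F i iℓ λ w iw → no-nbr w (inside i w iw)))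
      ... | no ∄iℓ = ¬¬helly-within g (S-ℓ ℓ) (shorter ℓ∈S) F
        (λ i t it → keep (inside i t it) λ { refl → ∄iℓ (i , it) }) no-common
      remove ℓ ℓ∈S (pendant p∈S ℓ~p unique) =
        ¬¬helly-within g (S-ℓ ℓ) (shorter ℓ∈S) family inside′ (no-common ∘ common⇒common ∘ proj₂)
        where
          open Contract F ℓ~p (λ i w iw → unique w (inside i w iw))
          inside′ : ∀ i t → contracted i t → t ∈ S-ℓ ℓ
          inside′ i t (inj₁ (it , t≢ℓ)) = keep (inside i t it) t≢ℓ
          inside′ i t (inj₂ (refl , _)) = keep p∈S p≢ℓ

  helly : ∀ {q} (F : SubtreeFamily q) → ∃ (Common F)
  helly F = decidable-stable (Fin.any? λ t → Fin.all? λ i → member? F i t)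
    (¬¬helly-within m (allFin m) (ℕ.≤-reflexive (List.length-tabulate _)) F (λ _ t _ → ∈-allFin t))

module _ {N : ℕ} {Γ : Graph N} (D : TreeDecomposition Γ) where

  open Subtrees (tree D) using (SubtreeFamily; helly)

  Occurs : Fin N → Fin (nodes D) → Set
  Occurs v t = v ∈ₛ bag D t

  Cooccur : Fin N → Fin N → Set
  Cooccur u v = ∃[ t ] (Occurs u t × Occurs v t)

  cooccur? : ∀ u v → Dec (Cooccur u v)
  cooccur? u v = Fin.any? λ t → (u ∈? bag D t) ×-dec (v ∈? bag D t)

  -- If the subtrees of B meet pairwise, Helly puts B in one bag.  Otherwise take b, b′ with
  -- disjoint subtrees: the subtree of b′ and the unions of those of A a and b meet pairwise
  -- (as A a ~ b′), and a common node of them lies outside the subtree of b, so in all of A.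
  complete-join-in-bag : ∀ {p q} (A : Fin p → Fin N) (B : Fin (suc q) → Fin N) →
                         (∀ a b → Adj Γ (A a) (B b)) →
                         (∃[ t ] ∀ b → Occurs (B b) t) ⊎ (∃[ t ] ∀ a → Occurs (A a) t)
  complete-join-in-bag {p} {q} A B A~B
    with Fin.any? (λ b → Fin.any? (λ b′ → ¬? (cooccur? (B b) (B b′))))
  ... | no ∄disjoint = inj₁ (helly B-subtrees)
    where
      B-subtrees : SubtreeFamily q
      B-subtrees = record
        { member       = Occurs ∘ B
        ; member?      = λ b t → B b ∈? bag D t
        ; connected    = coherent D ∘ B
        ; intersecting = λ b b′ → decidable-stable (cooccur? (B b) (B b′))
                                     λ disjoint → ∄disjoint (b , b′ , disjoint) }
  ... | yes (b , b′ , disjoint) with helly separated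
    where
      separated-member : Fin (suc p) → Fin (nodes D) → Set
      separated-member Fin.zero    = Occurs (B b′)
      separated-member (Fin.suc a) t = Occurs (A a) t ⊎ Occurs (B b) t

      separated : SubtreeFamily p
      separated = record
        { member       = separated-member
        ; member?      = member?
        ; connected    = connected
        ; intersecting = intersecting }
        where
          member? : ∀ i → Decidable (separated-member i)
          member? Fin.zero    t = B b′ ∈? bag D t
          member? (Fin.suc a) t = (A a ∈? bag D t) ⊎-dec (B b ∈? bag D t)
          connected : ∀ i → InducesConnected (Tree.graph (tree D)) (separated-member i)
          connected Fin.zero    = coherent D (B b′)
          connected (Fin.suc a) with edges D (A a) (B b) (A~B a b)
          ... | t , at , bt = ∪-connected (Tree.graph (tree D)) (coherent D (A a)) (coherent D (B b)) at bt
          intersecting : ∀ i j → ∃[ t ] (separated-member i t × separated-member j t)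
          intersecting Fin.zero Fin.zero with covers D (B b′)
          ... | t , b′t = t , b′t , b′t
          intersecting Fin.zero (Fin.suc a) with edges D (A a) (B b′) (A~B a b′)
          ... | t , at , b′t = t , b′t , inj₁ at
          intersecting (Fin.suc a) Fin.zero with edges D (A a) (B b′) (A~B a b′)
          ... | t , at , b′t = t , inj₁ at , b′t
          intersecting (Fin.suc a) (Fin.suc a′) with covers D (B b)
          ... | t , bt = t , inj₂ bt , inj₂ bt
  ... | t , common = inj₂ (t , λ a → in-A a (common (Fin.suc a)))
    where
      in-A : ∀ a → Occurs (A a) t ⊎ Occurs (B b) t → Occurs (A a) t
      in-A a (inj₁ at) = at
      in-A a (inj₂ bt) = ⊥-elim (disjoint (t , bt , common Fin.zero))

module _ {N : ℕ} (Γ : Graph N) where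

  CliqueLabelling : Subset N → ℕ → Set
  CliqueLabelling X k = Σ (∀ x → x ∈ₛ X → Fin k) λ label →
    ∀ x y (x∈X : x ∈ₛ X) (y∈X : y ∈ₛ X) → label x x∈X ≡ label y y∈X → x ≢ y → Adj Γ x y

  vcc⇒clique-labelling : ∀ {X k} → VccAtMost Γ X k → CliqueLabelling X k
  vcc⇒clique-labelling {X} {k} (Cs , cliques , ⋃Cs≡X , |Cs|≤k) = label , same-label⇒adjacent
    where
      clique-of : ∀ x → x ∈ₛ X → Any (x ∈ₛ_) Cs
      clique-of x x∈X = ∈⋃⁻ Cs (subst (x ∈ₛ_) (sym ⋃Cs≡X) x∈X)
      label : ∀ x → x ∈ₛ X → Fin k
      label x x∈X = inject≤ (Any.index (clique-of x x∈X)) |Cs|≤k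
      same-label⇒adjacent : ∀ x y (x∈X : x ∈ₛ X) (y∈X : y ∈ₛ X) →
                            label x x∈X ≡ label y y∈X → x ≢ y → Adj Γ x y
      same-label⇒adjacent x y x∈X y∈X same x≢y =
        proj₁ (All.lookupAny cliques (clique-of x x∈X)) x y
          (Any.lookup-result (clique-of x x∈X))
          (subst (λ i → y ∈ₛ List.lookup Cs i) (sym same-index) (Any.lookup-result (clique-of y y∈X)))
          x≢y
        where
          same-index : Any.index (clique-of x x∈X) ≡ Any.index (clique-of y y∈X)
          same-index = Fin.inject≤-injective |Cs|≤k |Cs|≤k _ _ same

  clique-labelling⇒vcc : ∀ {k} {X : Fin N → Set} (X? : Decidable X) (label : Fin N → Fin k) →
                         (∀ x y → X x → X y → label x ≡ label y → x ≢ y → Adj Γ x y) →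
                         VccAtMost Γ ⟦ X? ⟧ k
  clique-labelling⇒vcc {k} {X} X? label same-label⇒adjacent =
    Cs , All.tabulate⁺ class-clique , ⊆-antisym ⋃Cs⊆X X⊆⋃Cs , ℕ.≤-reflexive (List.length-tabulate class)
    where
      class? : (i : Fin k) → Decidable (λ x → X x × label x ≡ i)
      class? i x = X? x ×-dec (label x Fin.≟ i)
      class : Fin k → Subset N
      class i = ⟦ class? i ⟧
      Cs : List (Subset N)
      Cs = List.tabulate class
      class-clique : ∀ i → IsClique Γ (class i)
      class-clique i x y x∈ y∈ with ∈⟦⟧⁻ (class? i) x∈ | ∈⟦⟧⁻ (class? i) y∈
      ... | Xx , refl | Xy , ly = same-label⇒adjacent x y Xx Xy (sym ly)
      ⋃Cs⊆X : ⋃ Cs ⊆ ⟦ X? ⟧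
      ⋃Cs⊆X x∈ with Any.tabulate⁻ (∈⋃⁻ Cs x∈)
      ... | i , x∈i = ∈⟦⟧⁺ X? (proj₁ (∈⟦⟧⁻ (class? i) x∈i))
      X⊆⋃Cs : ⟦ X? ⟧ ⊆ ⋃ Cs
      X⊆⋃Cs {x} x∈ = ∈⋃⁺ Cs (Any.tabulate⁺ (label x) (∈⟦⟧⁺ (class? (label x)) (∈⟦⟧⁻ X? x∈ , refl)))

  clique-labelling⇒colourable : ∀ {n} (G : Graph n) {X k} (e : Fin n → Fin N) →
                                (∀ {u v} → e u ≡ e v → u ≡ v) →
                                (∀ u v → Adj G u v → ¬ Adj Γ (e u) (e v)) → (∀ u → e u ∈ₛ X) →
                                CliqueLabelling X k → Colourable G k
  clique-labelling⇒colourable G e e-injective e-anti e∈X (label , same-label⇒adjacent) =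
    (λ u → label (e u) (e∈X u)) , λ u v u~v same → e-anti u v u~v
      (same-label⇒adjacent (e u) (e v) (e∈X u) (e∈X v) same
        (λ eu≡ev → Graph.adj-irrefl G (subst (Adj G u) (sym (e-injective eu≡ev)) u~v)))

n≤k⇒colourable : ∀ {n k} (G : Graph n) → n ≤ k → Colourable G k
n≤k⇒colourable G n≤k = (λ u → inject≤ u n≤k) , λ u v u~v same →
  Graph.adj-irrefl G (subst (Adj G u) (sym (Fin.inject≤-injective n≤k n≤k u v same)) u~v)

complete : ∀ r → Graph r
complete r = record { Adj = _≢_ ; adj-sym = λ u≢v → u≢v ∘ sym ; adj-irrefl = λ u≢u → u≢u refl }

¬colourable-complete : ∀ {r k} → k < r → ¬ Colourable (complete r) k
¬colourable-complete k<r (colour , proper) with Fin.pigeonhole k<r colour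
... | i , j , i<j , same = proper i j (Fin.<⇒≢ i<j) same

module Star (q : ℕ) where

  StarAdj : Fin (suc q) → Fin (suc q) → Set
  StarAdj Fin.zero    Fin.zero    = ⊥
  StarAdj Fin.zero    (Fin.suc _) = ⊤
  StarAdj (Fin.suc _) Fin.zero    = ⊤
  StarAdj (Fin.suc _) (Fin.suc _) = ⊥

  star : Graph (suc q)
  star = record { Adj = StarAdj ; adj-sym = λ {u} {v} → symmetric u v ; adj-irrefl = λ {u} → irreflexive u }
    where
      symmetric : ∀ u v → StarAdj u v → StarAdj v u
      symmetric Fin.zero    (Fin.suc _) _ = tt
      symmetric (Fin.suc _) Fin.zero    _ = tt
      irreflexive : ∀ u → ¬ StarAdj u u
      irreflexive Fin.zero    ()
      irreflexive (Fin.suc _) ()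

  centre-between : ∀ {u v w} → StarAdj u v → StarAdj v w → u ≢ w → v ≡ Fin.zero
  centre-between {v = Fin.zero}                           _ _ _   = refl
  centre-between {Fin.zero} {Fin.suc _} {Fin.zero} _ _ u≢w = ⊥-elim (u≢w refl)

  -- Both c₁ and c₂ lie strictly between two distinct cycle vertices, so both are the centre.
  star-acyclic : ¬ HasCycle star
  star-acyclic (zero , c , injective , adjacent , closed) =
    contradiction (injective (trans c₁≡0 (sym c₂≡0))) λ ()
    where
      c₁≡0 : c (# 1) ≡ Fin.zero
      c₁≡0 = centre-between (adjacent (# 0)) (adjacent (# 1)) (λ e → contradiction (injective e) λ ())
      c₂≡0 : c (# 2) ≡ Fin.zero
      c₂≡0 = centre-between (adjacent (# 1)) closed (λ e → contradiction (injective e) λ ())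
  star-acyclic (suc r , c , injective , adjacent , closed) =
    contradiction (injective (trans c₁≡0 (sym c₂≡0))) λ ()
    where
      c₁≡0 : c (# 1) ≡ Fin.zero
      c₁≡0 = centre-between (adjacent (# 0)) (adjacent (# 1)) (λ e → contradiction (injective e) λ ())
      c₂≡0 : c (# 2) ≡ Fin.zero
      c₂≡0 = centre-between (adjacent (# 1)) (adjacent (# 2)) (λ e → contradiction (injective e) λ ())

  star-connected : ∀ {P} → P Fin.zero → InducesConnected star P
  star-connected P₀ Fin.zero    Fin.zero    Pu Pv = here Pu
  star-connected P₀ Fin.zero    (Fin.suc _) Pu Pv = step Pu tt (here Pv)
  star-connected P₀ (Fin.suc _) Fin.zero    Pu Pv = step Pu tt (here Pv)
  star-connected P₀ (Fin.suc _) (Fin.suc _) Pu Pv = step Pu tt (step P₀ tt (here Pv))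

  star-tree : Tree (suc q)
  star-tree = record { graph = star ; connected = star-connected tt ; acyclic = star-acyclic }

module _ {n : ℕ} (G : Graph n) where

  old : Fin n → Fin (n + suc n)
  old a = a ↑ˡ suc n

  new : Fin (suc n) → Fin (n + suc n)
  new j = n ↑ʳ j

  old~new : ∀ a j → Adj (H G) (old a) (new j)
  old~new a j rewrite Fin.splitAt-↑ˡ n a (suc n) | Fin.splitAt-↑ʳ n (suc n) j = tt

  edge⇒old≁old : ∀ u v → Adj G u v → ¬ Adj (H G) (old u) (old v)
  edge⇒old≁old u v u~v rewrite Fin.splitAt-↑ˡ n u (suc n) | Fin.splitAt-↑ˡ n v (suc n) =
    λ (_ , u≁v) → u≁v u~v

  new≁new : ∀ i j → ¬ Adj (H G) (new i) (new j)
  new≁new i j rewrite Fin.splitAt-↑ʳ n (suc n) i | Fin.splitAt-↑ʳ n (suc n) j = λ ()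

  tcl⇒colourable : ∀ {k} → TclAtMost (H G) k → Colourable G k
  tcl⇒colourable {k} (D , narrow) with n ℕ.≤? k
  ... | yes n≤k = n≤k⇒colourable G n≤k
  ... | no n≰k with complete-join-in-bag D old new old~new
  ...   | inj₁ (t , new∈t) = ⊥-elim (¬colourable-complete (ℕ.m<n⇒m<1+n (ℕ.≰⇒> n≰k))
          (clique-labelling⇒colourable (H G) (complete (suc n)) new (Fin.↑ʳ-injective n _ _)
            (λ i j _ → new≁new i j) new∈t (vcc⇒clique-labelling (H G) (narrow t))))
  ...   | inj₂ (t , old∈t) =
          clique-labelling⇒colourable (H G) G old (Fin.↑ˡ-injective (suc n) _ _)
            edge⇒old≁old old∈t (vcc⇒clique-labelling (H G) (narrow t))

module StarDecomposition {n k} (G : Graph n) (colour : Fin n → Fin k)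
                         (proper : ∀ u v → Adj G u v → colour u ≢ colour v) (i₀ : Fin k) where

  open Star (suc n)

  Side : Set
  Side = Fin n ⊎ Fin (suc n)

  InBag : Fin (2 + n) → Side → Set
  InBag t (inj₁ _) = ⊤
  InBag t (inj₂ j) = t ≡ Fin.suc j

  inBag? : ∀ t s → Dec (InBag t s)
  inBag? t (inj₁ _) = yes tt
  inBag? t (inj₂ j) = t Fin.≟ Fin.suc j

  label : Side → Fin k
  label = [ colour , const i₀ ]′

  same-label⇒adjacent : ∀ t s s′ → InBag t s → InBag t s′ → label s ≡ label s′ → s ≢ s′ →
                        ConeAdj (Adj (complement G)) s s′
  same-label⇒adjacent _ (inj₁ a) (inj₁ b) _ _ same a≢b =
    (λ { refl → a≢b refl }) , λ a~b → proper a b a~b same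
  same-label⇒adjacent _ (inj₁ _) (inj₂ _) _ _ _ _ = tt
  same-label⇒adjacent _ (inj₂ _) (inj₁ _) _ _ _ _ = tt
  same-label⇒adjacent _ (inj₂ _) (inj₂ _) refl refl _ i≢j = ⊥-elim (i≢j refl)

  covered : ∀ s → ∃[ t ] InBag t s
  covered (inj₁ _) = Fin.zero , tt
  covered (inj₂ j) = Fin.suc j , refl

  edge-covered : ∀ s s′ → ConeAdj (Adj (complement G)) s s′ → ∃[ t ] (InBag t s × InBag t s′)
  edge-covered (inj₁ _) (inj₁ _) _ = Fin.zero , tt , tt
  edge-covered (inj₁ _) (inj₂ j) _ = Fin.suc j , tt , refl
  edge-covered (inj₂ j) (inj₁ _) _ = Fin.suc j , refl , tt

  coherent-side : ∀ s → InducesConnected star (λ t → InBag t s)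
  coherent-side (inj₁ _) = star-connected tt
  coherent-side (inj₂ j) = singleton-connected star (Fin.suc j) (λ _ t≡ → t≡)

  vertex-in-bag? : ∀ t → Decidable (λ v → InBag t (splitAt n v))
  vertex-in-bag? t v = inBag? t (splitAt n v)

  bag-of : Fin (2 + n) → Subset (n + suc n)
  bag-of t = ⟦ vertex-in-bag? t ⟧

  decomposition : TreeDecomposition (H G)
  decomposition = record
    { nodes    = 2 + n
    ; tree     = star-tree
    ; bag      = bag-of
    ; covers   = λ v → let t , v∈t = covered (splitAt n v) in t , ∈⟦⟧⁺ (vertex-in-bag? t) v∈t
    ; edges    = λ u v u~v → let t , u∈t , v∈t = edge-covered (splitAt n u) (splitAt n v) u~v
                             in t , ∈⟦⟧⁺ (vertex-in-bag? t) u∈t , ∈⟦⟧⁺ (vertex-in-bag? t) v∈t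
    ; coherent = λ v t t′ v∈t v∈t′ → walk-map (λ t → ∈⟦⟧⁺ (vertex-in-bag? t))
                   (coherent-side (splitAt n v) t t′
                     (∈⟦⟧⁻ (vertex-in-bag? t) v∈t) (∈⟦⟧⁻ (vertex-in-bag? t′) v∈t′)) }

  narrow : ∀ t → VccAtMost (H G) (bag-of t) k
  narrow t = clique-labelling⇒vcc (H G) (vertex-in-bag? t) (label ∘ splitAt n)
    λ x y x∈t y∈t same x≢y → same-label⇒adjacent t _ _ x∈t y∈t same λ e → x≢y (splitAt-injective e)
    where
      splitAt-injective : ∀ {x y} → splitAt n x ≡ splitAt n y → x ≡ y
      splitAt-injective {x} {y} e = begin
        x                               ≡⟨ Fin.join-splitAt n (suc n) x ⟨
        Fin.join n (suc n) (splitAt n x) ≡⟨ cong (Fin.join n (suc n)) e ⟩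
        Fin.join n (suc n) (splitAt n y) ≡⟨ Fin.join-splitAt n (suc n) y ⟩
        y                               ∎
        where open ≡-Reasoning

colourable⇒tcl : ∀ {n k} (G : Graph n) → Fin k → Colourable G k → TclAtMost (H G) k
colourable⇒tcl G i₀ (colour , proper) = decomposition , narrow
  where open StarDecomposition G colour proper i₀

lemma6 : (k n : ℕ) → 1 ≤ k → (G : Graph n) → Colourable G k ⇔ TclAtMost (H G) k
lemma6 (suc k) n _ G = mk⇔ (colourable⇒tcl G Fin.zero) (tcl⇒colourable G)
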